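{- Let $M\in{\cal T}'$ be a correct term. (1) $M$ has no subterm of the form $(O\ N^\star)$. (2) If $(N^\star\ O)$ is a subterm of $M$, then $O=\boxed{\varepsilon}$ for some $\varepsilon$.
   Context: Intuitionistic variables $x,y,\dots$, classical variables $a,b,\dots$. Terms ${\cal T} ::= x \mid \lambda x\, {\cal T} \mid ({\cal T}\ {\cal E}) \mid \langle {\cal T},{\cal T}\rangle \mid \omega_1 {\cal T} \mid \omega_2 {\cal T} \mid \mu a\, {\cal T} \mid (a\ {\cal T})$, ${\cal E} ::= {\cal T} \mid \pi_1 \mid \pi_2 \mid [x.{\cal T}, y.{\cal T}]$. Marked terms ${\cal T}'$: the grammar of ${\cal T}$ extended with $N^\star$ (for $N\in{\cal T}$) and $\boxed{\varepsilon}$ (in argument position, for $\varepsilon\in{\cal T}\cup\{\pi_1,\pi_2\}$), with $N,\varepsilon$ unmarked and closed. $M\in{\cal T}'$ is acceptable iff $M=N^\star$, or $M=\mu aM_1$ and for each subterm $(a\ N)$ of $M$, $N$ is acceptable, or $M=(N\ [x_1.N_1,x_2.N_2])$ with $N_1,N_2$ acceptable. For acceptable $M$: $st(N^\star)=\{N^\star\}$, $st(\mu aM_1)=\bigcup\{st(S)\mid(a\ S)$ subterm of $M_1\}$, $st((N\ [x_1.N_1,x_2.N_2]))=st(N_1)\cup st(N_2)$. $M\in{\cal T}'$ is correct if (1) each occurrence of a subterm $\boxed{\varepsilon}$ appears as $(U\ \boxed{\varepsilon})$ for some acceptable $U$, and (2) for each occurrence of a subterm $N^\star$ of $M$ there is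 a (necessarily unique) subterm of the form $(U\ \boxed{\varepsilon})$ such that $N^\star\in st(U)$. -}

module Defs where

open import Data.Nat using (ℕ)
open import Data.Unit using (⊤)
open import Data.Product using (_×_; Σ; ∃)
open import Relation.Nullary using (¬_)
open import Relation.Binary.PropositionalEquality using (_≡_; _≢_)

-- Variables are named by natural numbers. Intuitionistic variables (x,y,...)
-- and classical variables (a,b,...) live in separate namespaces.
IVar : Set
IVar = ℕ

CVar : Set
CVar = ℕ

mutual
  data Tm : Set where
    var  : IVar → Tm
    lam  : IVar → Tm → Tm
    app  : Tm → El → Tm
    pair : Tm → Tm → Tm
    ω₁   : Tm → Tm
    ω₂   : Tm → Tm
    mu   : CVar → Tm → Tm
    capp : CVar → Tm → Tm

  data El : Set where
    term : Tm → El
    π₁   : El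
    π₂   : El
    case : IVar → Tm → IVar → Tm → El

mutual
  data FreeI (z : IVar) : Tm → Set where
    f-var   : FreeI z (var z)
    f-lam   : ∀ {x M} → x ≢ z → FreeI z M → FreeI z (lam x M)
    f-appL  : ∀ {M E} → FreeI z M → FreeI z (app M E)
    f-appR  : ∀ {M E} → FreeIE z E → FreeI z (app M E)
    f-pairL : ∀ {M N} → FreeI z M → FreeI z (pair M N)
    f-pairR : ∀ {M N} → FreeI z N → FreeI z (pair M N)
    f-ω₁    : ∀ {M} → FreeI z M → FreeI z (ω₁ M)
    f-ω₂    : ∀ {M} → FreeI z M → FreeI z (ω₂ M)
    f-mu    : ∀ {a M} → FreeI z M → FreeI z (mu a M)
    f-capp  : ∀ {a M} → FreeI z M → FreeI z (capp a M)

  data FreeIE (z : IVar) : El → Set where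
    f-term  : ∀ {M} → FreeI z M → FreeIE z (term M)
    f-case₁ : ∀ {x M y N} → x ≢ z → FreeI z M → FreeIE z (case x M y N)
    f-case₂ : ∀ {x M y N} → y ≢ z → FreeI z N → FreeIE z (case x M y N)

mutual
  data FreeC (c : CVar) : Tm → Set where
    f-lam   : ∀ {x M} → FreeC c M → FreeC c (lam x M)
    f-appL  : ∀ {M E} → FreeC c M → FreeC c (app M E)
    f-appR  : ∀ {M E} → FreeCE c E → FreeC c (app M E)
    f-pairL : ∀ {M N} → FreeC c M → FreeC c (pair M N)
    f-pairR : ∀ {M N} → FreeC c N → FreeC c (pair M N)
    f-ω₁    : ∀ {M} → FreeC c M → FreeC c (ω₁ M)
    f-ω₂    : ∀ {M} → FreeC c M → FreeC c (ω₂ M)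
    f-mu    : ∀ {a M} → a ≢ c → FreeC c M → FreeC c (mu a M)
    f-cvar  : ∀ {M} → FreeC c (capp c M)
    f-capp  : ∀ {a M} → FreeC c M → FreeC c (capp a M)

  data FreeCE (c : CVar) : El → Set where
    f-term  : ∀ {M} → FreeC c M → FreeCE c (term M)
    f-case₁ : ∀ {x M y N} → FreeC c M → FreeCE c (case x M y N)
    f-case₂ : ∀ {x M y N} → FreeC c N → FreeCE c (case x M y N)

Closed : Tm → Set
Closed N = (∀ x → ¬ FreeI x N) × (∀ a → ¬ FreeC a N)

data BoxArg : Set where
  bterm : Tm → BoxArg
  bπ₁   : BoxArg
  bπ₂   : BoxArg

ClosedB : BoxArg → Set
ClosedB (bterm N) = Closed N
ClosedB bπ₁ = ⊤
ClosedB bπ₂ = ⊤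

mutual
  data Tm' : Set where
    var  : IVar → Tm'
    lam  : IVar → Tm' → Tm'
    app  : Tm' → El' → Tm'
    pair : Tm' → Tm' → Tm'
    ω₁   : Tm' → Tm'
    ω₂   : Tm' → Tm'
    mu   : CVar → Tm' → Tm'
    capp : CVar → Tm' → Tm'
    star : Tm → Tm'

  data El' : Set where
    term : Tm' → El'
    π₁   : El'
    π₂   : El'
    case : IVar → Tm' → IVar → Tm' → El'
    box  : BoxArg → El'

-- Subterm occurrences: an element of  Sub P M  is a position (path) of an
-- occurrence of P inside M.  The contents of N⋆ and of boxes are unmarked
-- and are not descended into (they contain no marked constructs).

data Sub (P : Tm') : Tm' → Set where
  here   : Sub P P
  s-lam  : ∀ {x M} → Sub P M → Sub P (lam x M)
  s-appL : ∀ {M E} → Sub P M → Sub P (app M E)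
  s-appR : ∀ {O M} → Sub P M → Sub P (app O (term M))
  s-case₁ : ∀ {O x M y N} → Sub P M → Sub P (app O (case x M y N))
  s-case₂ : ∀ {O x M y N} → Sub P N → Sub P (app O (case x M y N))
  s-pairL : ∀ {M N} → Sub P M → Sub P (pair M N)
  s-pairR : ∀ {M N} → Sub P N → Sub P (pair M N)
  s-ω₁   : ∀ {M} → Sub P M → Sub P (ω₁ M)
  s-ω₂   : ∀ {M} → Sub P M → Sub P (ω₂ M)
  s-mu   : ∀ {a M} → Sub P M → Sub P (mu a M)
  s-capp : ∀ {a M} → Sub P M → Sub P (capp a M)

_⊙_ : ∀ {P Q M} → Sub P Q → Sub Q M → Sub P M
p ⊙ here = p
p ⊙ s-lam q = s-lam (p ⊙ q)
p ⊙ s-appL q = s-appL (p ⊙ q)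
p ⊙ s-appR q = s-appR (p ⊙ q)
p ⊙ s-case₁ q = s-case₁ (p ⊙ q)
p ⊙ s-case₂ q = s-case₂ (p ⊙ q)
p ⊙ s-pairL q = s-pairL (p ⊙ q)
p ⊙ s-pairR q = s-pairR (p ⊙ q)
p ⊙ s-ω₁ q = s-ω₁ (p ⊙ q)
p ⊙ s-ω₂ q = s-ω₂ (p ⊙ q)
p ⊙ s-mu q = s-mu (p ⊙ q)
p ⊙ s-capp q = s-capp (p ⊙ q)

WellMarked : Tm' → Set
WellMarked M =
  (∀ N → Sub (star N) M → Closed N) ×
  (∀ U ε → Sub (app U (box ε)) M → ClosedB ε)

data Acceptable : Tm' → Set where
  acc-star : ∀ {N} → Acceptable (star N)
  acc-mu   : ∀ {a M₁} → (∀ S → Sub (capp a S) M₁ → Acceptable S) →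
             Acceptable (mu a M₁)
  acc-case : ∀ {N x₁ N₁ x₂ N₂} → Acceptable N₁ → Acceptable N₂ →
             Acceptable (app N (case x₁ N₁ x₂ N₂))

-- st(U), as a set of occurrences: an element of  StPos U N  is an occurrence
-- of N⋆ inside U that belongs to st(U), following the recursive definition.
data StPos : Tm' → Tm → Set where
  st-star  : ∀ {N} → StPos (star N) N
  st-mu    : ∀ {a M₁ S N} → Sub (capp a S) M₁ → StPos S N → StPos (mu a M₁) N
  st-case₁ : ∀ {O x₁ N₁ x₂ N₂ N} → StPos N₁ N → StPos (app O (case x₁ N₁ x₂ N₂)) N
  st-case₂ : ∀ {O x₁ N₁ x₂ N₂ N} → StPos N₂ N → StPos (app O (case x₁ N₁ x₂ N₂)) N

stSub : ∀ {U N} → StPos U N → Sub (star N) U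
stSub st-star = here
stSub (st-mu p s) = s-mu (s-capp (stSub s) ⊙ p)
stSub (st-case₁ s) = s-case₁ (stSub s)
stSub (st-case₂ s) = s-case₂ (stSub s)

Correct : Tm' → Set
Correct M =
  (∀ U ε → Sub (app U (box ε)) M → Acceptable U) ×
  (∀ N (p : Sub (star N) M) →
     Σ Tm' λ U → Σ BoxArg λ ε → Σ (Sub (app U (box ε)) M) λ q →
       Σ (StPos U N) λ s → p ≡ (s-appL (stSub s) ⊙ q))

-- Track the edge joining an occurrence to its parent: argument of an
-- application, function part of an application to a given eliminator, or
-- anything else; it composes along positions.  Correctness places every N⋆
-- at stSub s inside some (U [ε]), and the clauses of st descend only through
-- μ, (a _) and case branches, so the edge above N⋆ is either the function
-- edge of (N⋆ [ε]) (when U = N⋆) or "other": never an argument edge, and a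
-- function edge only ever meets a box.
module Submission where

open import Defs
open import Data.Maybe using (Maybe; just; nothing; _<∣>_)
open import Data.Maybe.Properties using (<∣>-assoc; <∣>-identityʳ)
open import Data.Product using (_×_; Σ; _,_)
open import Relation.Nullary using (¬_)
open import Relation.Binary.PropositionalEquality
  using (_≡_; refl; sym; trans; cong; subst)

data Edge : Set where
  argument : Edge
  function : El' → Edge
  other    : Edge

-- nothing for the empty position, the edge nearest to P otherwise
innermost : ∀ {P M} → Sub P M → Maybe Edge
innermost here               = nothing
innermost (s-appL {E = E} q) = innermost q <∣> just (function E)
innermost (s-appR q)         = innermost q <∣> just argument
innermost (s-lam q)          = innermost q <∣> just other
innermost (s-case₁ q)        = innermost q <∣> just other
innermost (s-case₂ q)        = innermost q <∣> just other
innermost (s-pairL q)        = innermost q <∣> just other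
innermost (s-pairR q)        = innermost q <∣> just other
innermost (s-ω₁ q)           = innermost q <∣> just other
innermost (s-ω₂ q)           = innermost q <∣> just other
innermost (s-mu q)           = innermost q <∣> just other
innermost (s-capp q)         = innermost q <∣> just other

<∣>-extend : ∀ {A : Set} (b c : Maybe A) {a e} →
             a ≡ b <∣> c → a <∣> just e ≡ b <∣> (c <∣> just e)
<∣>-extend b c {e = e} eq = trans (cong (_<∣> just e) eq) (<∣>-assoc b c (just e))

innermost-⊙ : ∀ {P Q M} (p : Sub P Q) (q : Sub Q M) →
              innermost (p ⊙ q) ≡ innermost p <∣> innermost q
innermost-⊙ p here        = sym (<∣>-identityʳ (innermost p))
innermost-⊙ p (s-appL q)  = <∣>-extend (innermost p) (innermost q) (innermost-⊙ p q)
innermost-⊙ p (s-appR q)  = <∣>-extend (innermost p) (innermost q) (innermost-⊙ p q)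
innermost-⊙ p (s-lam q)   = <∣>-extend (innermost p) (innermost q) (innermost-⊙ p q)
innermost-⊙ p (s-case₁ q) = <∣>-extend (innermost p) (innermost q) (innermost-⊙ p q)
innermost-⊙ p (s-case₂ q) = <∣>-extend (innermost p) (innermost q) (innermost-⊙ p q)
innermost-⊙ p (s-pairL q) = <∣>-extend (innermost p) (innermost q) (innermost-⊙ p q)
innermost-⊙ p (s-pairR q) = <∣>-extend (innermost p) (innermost q) (innermost-⊙ p q)
innermost-⊙ p (s-ω₁ q)    = <∣>-extend (innermost p) (innermost q) (innermost-⊙ p q)
innermost-⊙ p (s-ω₂ q)    = <∣>-extend (innermost p) (innermost q) (innermost-⊙ p q)
innermost-⊙ p (s-mu q)    = <∣>-extend (innermost p) (innermost q) (innermost-⊙ p q)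
innermost-⊙ p (s-capp q)  = <∣>-extend (innermost p) (innermost q) (innermost-⊙ p q)

-- the edges through which the clauses of st descend, seen from the star
data StEdge : Maybe Edge → Set where
  root  : StEdge nothing
  inner : StEdge (just other)

descend : ∀ {m} → StEdge m → StEdge (m <∣> just other)
descend root  = inner
descend inner = inner

descend-μ : ∀ {m} r → StEdge m → StEdge (((m <∣> just other) <∣> r) <∣> just other)
descend-μ _ root  = inner
descend-μ _ inner = inner

stSub-edge : ∀ {U N} (s : StPos U N) → StEdge (innermost (stSub s))
stSub-edge st-star      = root
stSub-edge (st-case₁ s) = descend (stSub-edge s)
stSub-edge (st-case₂ s) = descend (stSub-edge s)
stSub-edge (st-mu p s)  =
  subst StEdge (sym (cong (_<∣> just other) (innermost-⊙ (s-capp (stSub s)) p)))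
        (descend-μ (innermost p) (stSub-edge s))

data StarEdge : Maybe Edge → Set where
  boxed : ∀ ε → StarEdge (just (function (box ε)))
  inner : StarEdge (just other)

correct⇒starEdge : ∀ {M N} → Correct M → (p : Sub (star N) M) → StarEdge (innermost p)
correct⇒starEdge (_ , stars-in-st) p with stars-in-st _ p
... | _ , ε , q , s , refl =
  subst StarEdge (sym (innermost-⊙ (s-appL (stSub s)) q)) (below-box (stSub-edge s))
  where
  below-box : ∀ {m r} → StEdge m → StarEdge ((m <∣> just (function (box ε))) <∣> r)
  below-box root  = boxed ε
  below-box inner = inner

lemma5p6 : (M : Tm') → WellMarked M → Correct M →
    ((O : Tm') (N : Tm) → ¬ Sub (app O (term (star N))) M) ×
    ((N : Tm) (O : El') → Sub (app (star N) O) M → Σ BoxArg λ ε → O ≡ box ε)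
lemma5p6 M _ correct = no-star-argument , star-function-boxed
  where
  no-star-argument : (O : Tm') (N : Tm) → ¬ Sub (app O (term (star N))) M
  no-star-argument O N r
    with subst StarEdge (innermost-⊙ (s-appR here) r) (correct⇒starEdge correct (s-appR here ⊙ r))
  ... | ()

  star-function-boxed : (N : Tm) (O : El') → Sub (app (star N) O) M → Σ BoxArg λ ε → O ≡ box ε
  star-function-boxed N O r
    with subst StarEdge (innermost-⊙ (s-appL here) r) (correct⇒starEdge correct (s-appL here ⊙ r))
  ... | boxed ε = ε , refl
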